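{- If $X \subseteq \mathbb{Z}^2$ is a finite shape, then the full grid graph of $X^2$ has a Hamiltonian cycle.
   Context: Let $U_2 = \{(0,1),(1,0),(0,-1),(-1,0)\}$. The full grid graph on $V \subseteq \mathbb{Z}^2$ has vertex set $V$ and an edge between $\vec a,\vec b \in V$ iff $\vec a - \vec b \in U_2$. A shape is a set $X \subseteq \mathbb{Z}^2$ whose full grid graph is connected. For a shape $X$, $X^2 = \{(x,y) \in \mathbb{Z}^2 : (\lfloor x/2 \rfloor, \lfloor y/2 \rfloor) \in X\}$, i.e. each point of $X$ is replaced by a $2\times 2$ block of points. -}

module Defs where

open import Data.Integer using (ℤ; +_; -[1+_]; _-_; _/ℕ_)
open import Data.Product using (_×_; _,_; Σ; ∃; ∃-syntax)
open import Data.List using (List; []; _∷_; length; head; last)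
open import Data.List.Membership.Propositional using (_∈_)
open import Data.List.Relation.Unary.Unique.Propositional using (Unique)
open import Data.List.Relation.Unary.Linked using (Linked)
open import Data.Nat using (_≤_)
open import Data.Maybe using (just)
open import Relation.Binary.PropositionalEquality using (_≡_)
open import Function.Bundles using (_⇔_)

Point : Set
Point = ℤ × ℤ

U₂ : List Point
U₂ = (+ 0 , + 1) ∷ (+ 1 , + 0) ∷ (+ 0 , -[1+ 0 ]) ∷ (-[1+ 0 ] , + 0) ∷ []

_-ᵖ_ : Point → Point → Point
(a₁ , a₂) -ᵖ (b₁ , b₂) = (a₁ - b₁ , a₂ - b₂)

Adj : (V : Point → Set) → Point → Point → Set
Adj V a b = V a × V b × ((a -ᵖ b) ∈ U₂)

record Walk (V : Point → Set) (a b : Point) : Set where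
  field
    verts  : List Point
    start  : head verts ≡ just a
    end    : last verts ≡ just b
    steps  : Linked (Adj V) verts

Connected : (Point → Set) → Set
Connected V = (∃[ v ] V v) × (∀ a b → V a → V b → Walk V a b)

Finite : (Point → Set) → Set
Finite X = ∃[ xs ] (∀ p → X p ⇔ p ∈ xs)

Shape : (Point → Set) → Set
Shape X = Connected X

-- X² = {(x,y) : (⌊x/2⌋,⌊y/2⌋) ∈ X}; for a positive divisor _/ℕ_ is floor division.
Blowup : (Point → Set) → (Point → Set)
Blowup X (x , y) = X (x /ℕ 2 , y /ℕ 2)

record HamiltonianCycle (V : Point → Set) : Set where
  field
    cycle    : List Point
    long     : 3 ≤ length cycle
    distinct : Unique cycle
    spanning : ∀ p → V p ⇔ p ∈ cycle
    path     : Linked (Adj V) cycle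
    closing  : ∀ a b → last cycle ≡ just a → head cycle ≡ just b → Adj V a b

module Submission where

-- Grow the region one block of X at a time, always attaching a block q that is adjacent to a
-- block p already present, and keep a Hamiltonian cycle on the corners of the current blocks
-- that runs along every boundary side of the region counter-clockwise. The side of p facing q
-- is then a cycle edge u → v; replacing it by u, the four corners of q counter-clockwise, v
-- gives a cycle for the larger region in which the three other sides of q are again
-- counter-clockwise cycle edges, while no other boundary side is lost. Finiteness of X stops
-- the growth, and connectivity of X makes it reach every block.

open import Data.Bool using (Bool; true; false)
open import Data.Empty using (⊥-elim)
open import Data.Integer using (ℤ; +_; -[1+_]; _+_; _-_; _*_; -_; ∣_∣; _/ℕ_; _%ℕ_; _≟_)
open import Data.Integer.DivMod using (a≡a%ℕn+[a/ℕn]*n; n%ℕd<d)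
open import Data.Integer.Properties using (abs-*; +-identityʳ; *-cancelˡ-≡; +-0-abelianGroup)
open import Data.Integer.Tactic.RingSolver using (solve-∀)
open import Data.List using (List; []; _∷_; _++_; head; last; map; length; filter)
open import Data.List.Properties using (filter-notAll)
open import Data.List.Membership.Propositional using (_∈_; _∉_; find; lose)
open import Data.List.Membership.Propositional.Properties
  using (∈-map⁺; ∈-map⁻; ∈-++⁻; ∈-++⁺ˡ; ∈-++⁺ʳ; ∈-filter⁺)
open import Data.List.Relation.Binary.Disjoint.Propositional using (Disjoint)
open import Data.List.Relation.Binary.Permutation.Propositional
  using (_↭_; prep; ↭-refl; ↭-sym; ↭-trans; ↭⇒↭ₛ)
open import Data.List.Relation.Binary.Permutation.Propositional.Properties using (shift; ∈-resp-↭; ↭-length)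
import Data.List.Relation.Binary.Permutation.Setoid.Properties as PermutationSetoid
open import Data.List.Relation.Binary.Subset.Propositional using (_⊆_)
import Data.List.Relation.Unary.All as All
open All using (All; []; _∷_)
open import Data.List.Relation.Unary.All.Properties using (last⁺)
open import Data.List.Relation.Unary.AllPairs using ([]; _∷_)
open import Data.List.Relation.Unary.Any using (here; there; any?)
import Data.List.Relation.Unary.Linked as Linked
open Linked using (Linked; []; [-]; _∷_)
open import Data.List.Relation.Unary.Unique.Propositional using (Unique)
import Data.List.Relation.Unary.Unique.Propositional.Properties as Unique
open import Data.Maybe using (just)
open import Data.Maybe.Properties using (just-injective)
import Data.Maybe.Relation.Unary.All as Maybe
open import Data.Nat as ℕ using (suc; s≤s; _≤_; _<_)
import Data.Nat.Properties as ℕ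
open import Data.Product using (_×_; _,_; proj₁; proj₂; ∃; ∃₂)
open import Data.Product.Properties using (≡-dec)
open import Data.Sum using (_⊎_; inj₁; inj₂)
open import Function using (id; _∘_)
open import Function.Bundles using (_⇔_; mk⇔; Equivalence)
open import Relation.Binary.PropositionalEquality
open import Relation.Nullary using (¬_; Dec; yes; no; ¬?)
open import Relation.Nullary.Decidable using (True; toWitness; _×-dec_)

open import Algebra.Properties.AbelianGroup +-0-abelianGroup using (∙-cancelʳ)
open import Data.List.Membership.DecPropositional (≡-dec _≟_ _≟_) using (_∈?_)

open import Defs

open ≡-Reasoning

module _ {A : Set} where

  data Consecutive (u v : A) : List A → Set where
    here  : ∀ {w} → Consecutive u v (u ∷ v ∷ w)
    there : ∀ {x w} → Consecutive u v w → Consecutive u v (x ∷ w)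

  Unique-resp-↭ : ∀ {xs ys : List A} → xs ↭ ys → Unique xs → Unique ys
  Unique-resp-↭ = PermutationSetoid.Unique-resp-↭ (setoid A) ∘ ↭⇒↭ₛ

  All-last : ∀ {P : A → Set} {zs a} → All P zs → last zs ≡ just a → P a
  All-last Pzs last≡ with subst (Maybe.All _) last≡ (last⁺ Pzs)
  ... | Maybe.just Pa = Pa

  consecutive-++ʳ : ∀ {u v w} M → Consecutive u v w → Consecutive u v (w ++ M)
  consecutive-++ʳ M here      = here
  consecutive-++ʳ M (there c) = there (consecutive-++ʳ M c)

  consecutive-++ˡ : ∀ {u v w} L → Consecutive u v w → Consecutive u v (L ++ w)
  consecutive-++ˡ []      c = c
  consecutive-++ˡ (x ∷ L) c = there (consecutive-++ˡ L c)

  last-++-∷ : ∀ M {y : A} {w} → last (M ++ y ∷ w) ≡ last (y ∷ w)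
  last-++-∷ []          = refl
  last-++-∷ (_ ∷ [])    = refl
  last-++-∷ (_ ∷ _ ∷ M) = last-++-∷ (_ ∷ M)

  splice : ∀ {x y w} → List A → Consecutive x y w → List A
  splice {x} {y} N (here {w}) = x ∷ N ++ y ∷ w
  splice N (there {x = z} c)  = z ∷ splice N c

  module _ {x y : A} (N : List A) where

    splice-inner : ∀ {u v w} (c : Consecutive x y w) → Consecutive u v N → Consecutive u v (splice N c)
    splice-inner {w = _ ∷ _ ∷ w} here e = there (consecutive-++ʳ (y ∷ w) e)
    splice-inner (there c) e            = there (splice-inner c e)

    splice-outer : ∀ {u v w} (c : Consecutive x y w) → Consecutive u v w → ¬ (u ≡ x × v ≡ y) →
                   Consecutive u v (splice N c)
    splice-outer here              here      uv≢xy = ⊥-elim (uv≢xy (refl , refl))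
    splice-outer here              (there e) _   = there (consecutive-++ˡ N e)
    splice-outer (there here)      here      _   = here
    splice-outer (there (there c)) here      _   = here
    splice-outer (there c)         (there e) uv≢xy = there (splice-outer c e uv≢xy)

    splice-↭ : ∀ {w} (c : Consecutive x y w) → splice N c ↭ N ++ w
    splice-↭ {w = _ ∷ _ ∷ w} here = ↭-sym (shift x N (y ∷ w))
    splice-↭ (there {x = z} {w} c) = ↭-trans (prep z (splice-↭ c)) (↭-sym (shift z N w))

    module _ {R : A → A → Set} where

      linked-join : ∀ {y} M {w} → Linked R (M ++ y ∷ []) → Linked R (y ∷ w) → Linked R (M ++ y ∷ w)
      linked-join []          _         l = l
      linked-join (_ ∷ [])    (r ∷ _)   l = r ∷ l
      linked-join (_ ∷ _ ∷ M) (r ∷ l′)  l = r ∷ linked-join (_ ∷ M) l′ l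

      splice-linked : ∀ {w} (c : Consecutive x y w) → Linked R w → Linked R (x ∷ N ++ y ∷ []) →
                      Linked R (splice N c)
      splice-linked here              (_ ∷ l) detour = linked-join (x ∷ N) detour l
      splice-linked (there here)      (r ∷ l) detour = r ∷ splice-linked here l detour
      splice-linked (there (there c)) (r ∷ l) detour = r ∷ splice-linked (there c) l detour

    last-splice : ∀ {w} (c : Consecutive x y w) → last (splice N c) ≡ last w
    last-splice here              = last-++-∷ (x ∷ N)
    last-splice (there here)      = last-splice here
    last-splice (there (there c)) = last-splice (there c)

    splice-closed : ∀ {s t} (c : Consecutive x y (s ∷ t)) →
                    ∃ λ t′ → splice N c ≡ s ∷ t′ × t′ ↭ N ++ t × last t′ ≡ last t
    splice-closed here      = _ , refl , ↭-refl , last-++-∷ N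
    splice-closed (there c) = _ , refl , splice-↭ c , last-splice c

bit : Bool → ℤ
bit false = + 0
bit true  = + 1

even≢odd : ∀ a b → + 2 * a ≢ + 2 * b + + 1
even≢odd a b eq = ℕ.even≢odd ∣ a - b ∣ 0 (begin
  2 ℕ.* ∣ a - b ∣   ≡⟨ abs-* (+ 2) (a - b) ⟨
  ∣ + 2 * (a - b) ∣ ≡⟨ cong ∣_∣ twice-difference ⟩
  1                 ∎)
  where
  twice-difference : + 2 * (a - b) ≡ + 1
  twice-difference = begin
    + 2 * (a - b)           ≡⟨ distrib a b ⟩
    + 2 * a - + 2 * b       ≡⟨ cong (_- + 2 * b) eq ⟩
    + 2 * b + + 1 - + 2 * b ≡⟨ cancel b ⟩
    + 1                     ∎
    where
    distrib : ∀ a b → + 2 * (a - b) ≡ + 2 * a - + 2 * b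
    distrib = solve-∀
    cancel : ∀ b → + 2 * b + + 1 - + 2 * b ≡ + 1
    cancel = solve-∀

2a+bit-injective : ∀ {a b} i j → + 2 * a + bit i ≡ + 2 * b + bit j → a ≡ b × i ≡ j
2a+bit-injective {a} {b} false false eq = *-cancelˡ-≡ (+ 2) a b (∙-cancelʳ (+ 0) _ _ eq) , refl
2a+bit-injective {a} {b} true  true  eq = *-cancelˡ-≡ (+ 2) a b (∙-cancelʳ (+ 1) _ _ eq) , refl
2a+bit-injective {a} {b} false true  eq = ⊥-elim (even≢odd a b (trans (sym (+-identityʳ _)) eq))
2a+bit-injective {a} {b} true  false eq = ⊥-elim (even≢odd b a (trans (sym (+-identityʳ _)) (sym eq)))

x≡2[x/ℕ2]+bit : ∀ x → ∃ λ i → x ≡ + 2 * (x /ℕ 2) + bit i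
x≡2[x/ℕ2]+bit x = remainder (x %ℕ 2) (n%ℕd<d x 2) (a≡a%ℕn+[a/ℕn]*n x 2)
  where
  reorder : ∀ r q → + r + q * + 2 ≡ + 2 * q + + r
  reorder r = solve-∀
  remainder : ∀ r → r ℕ.< 2 → x ≡ + r + (x /ℕ 2) * + 2 → ∃ λ i → x ≡ + 2 * (x /ℕ 2) + bit i
  remainder 0 _ eq = false , trans eq (reorder 0 (x /ℕ 2))
  remainder 1 _ eq = true  , trans eq (reorder 1 (x /ℕ 2))
  remainder (suc (suc _)) (ℕ.s≤s (ℕ.s≤s ())) _

[2a+bit]/ℕ2≡a : ∀ a i → (+ 2 * a + bit i) /ℕ 2 ≡ a
[2a+bit]/ℕ2≡a a i with x≡2[x/ℕ2]+bit (+ 2 * a + bit i)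
... | j , eq = sym (proj₁ (2a+bit-injective i j eq))

Bits : Set
Bits = Bool × Bool

corner : Point → Bits → Point
corner (a , b) (i , j) = (+ 2 * a + bit i , + 2 * b + bit j)

block : Point → Point
block (x , y) = (x /ℕ 2 , y /ℕ 2)

block-corner : ∀ q i → block (corner q i) ≡ q
block-corner (a , b) (i , j) = cong₂ _,_ ([2a+bit]/ℕ2≡a a i) ([2a+bit]/ℕ2≡a b j)

corner-block : ∀ z → ∃ λ i → z ≡ corner (block z) i
corner-block (x , y) with x≡2[x/ℕ2]+bit x | x≡2[x/ℕ2]+bit y
... | i , x≡ | j , y≡ = (i , j) , cong₂ _,_ x≡ y≡

corner-injective : ∀ {q q′} i j → corner q i ≡ corner q′ j → q ≡ q′ × i ≡ j
corner-injective {a , b} {a′ , b′} (i₁ , i₂) (j₁ , j₂) eq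
  with 2a+bit-injective {a} {a′} i₁ j₁ (cong proj₁ eq) | 2a+bit-injective {b} {b′} i₂ j₂ (cong proj₂ eq)
... | refl , refl | refl , refl = refl , refl

infix 4 _∼_
_∼_ : Point → Point → Set
x ∼ y = (x -ᵖ y) ∈ U₂

decide∈U₂ : ∀ {c} {c∈? : True (c ∈? U₂)} → c ∈ U₂
decide∈U₂ {c∈? = c∈?} = toWitness c∈?

∼-sym : ∀ {x y} → x ∼ y → y ∼ x
∼-sym {x₁ , x₂} {y₁ , y₂} x∼y =
  subst (_∈ U₂) (cong₂ _,_ (neg-minus x₁ y₁) (neg-minus x₂ y₂)) (negate x∼y)
  where
  neg-minus : ∀ a b → - (a - b) ≡ b - a
  neg-minus = solve-∀
  negate : ∀ {c₁ c₂} → (c₁ , c₂) ∈ U₂ → (- c₁ , - c₂) ∈ U₂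
  negate (here refl)                         = decide∈U₂
  negate (there (here refl))                 = decide∈U₂
  negate (there (there (here refl)))         = decide∈U₂
  negate (there (there (there (here refl)))) = decide∈U₂

data Direction : Set where
  south east north west : Direction

next : Direction → Direction
next south = east
next east  = north
next north = west
next west  = south

prev : Direction → Direction
prev south = west
prev east  = south
prev north = east
prev west  = north

opposite : Direction → Direction
opposite d = next (next d)

next-prev : ∀ d → next (prev d) ≡ d
next-prev south = refl
next-prev east  = refl
next-prev north = refl
next-prev west  = refl

-- The vector p -ᵖ neighbour p d, so that p ∼ neighbour p d in the orientation of Adj.
edgeVector : Direction → Point
edgeVector south = (+ 0 , + 1)
edgeVector east  = (-[1+ 0 ] , + 0)
edgeVector north = (+ 0 , -[1+ 0 ])
edgeVector west  = (+ 1 , + 0)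

neighbour : Point → Direction → Point
neighbour p d = p -ᵖ edgeVector d

edgeVector-opposite : ∀ d → edgeVector (opposite d) ≡ (- proj₁ (edgeVector d) , - proj₂ (edgeVector d))
edgeVector-opposite south = refl
edgeVector-opposite east  = refl
edgeVector-opposite north = refl
edgeVector-opposite west  = refl

neighbour-opposite : ∀ p d → neighbour (neighbour p d) (opposite d) ≡ p
neighbour-opposite (a , b) d rewrite edgeVector-opposite d =
  cong₂ _,_ (cancel a (proj₁ (edgeVector d))) (cancel b (proj₂ (edgeVector d)))
  where
  cancel : ∀ a e → a - e - - e ≡ a
  cancel = solve-∀

∈U₂⇒edgeVector : ∀ {c} → c ∈ U₂ → ∃ λ d → c ≡ edgeVector d
∈U₂⇒edgeVector (here refl)                         = south , refl
∈U₂⇒edgeVector (there (here refl))                 = west , refl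
∈U₂⇒edgeVector (there (there (here refl)))         = north , refl
∈U₂⇒edgeVector (there (there (there (here refl)))) = east , refl

∼⇒neighbour : ∀ {x y} → x ∼ y → ∃ λ d → y ≡ neighbour x d
∼⇒neighbour {x₁ , x₂} {y₁ , y₂} x∼y with ∈U₂⇒edgeVector x∼y
... | d , eq = d , cong₂ _,_ (trans (back x₁ y₁) (cong (λ e → x₁ - proj₁ e) eq))
                            (trans (back x₂ y₂) (cong (λ e → x₂ - proj₂ e) eq))
  where
  back : ∀ a b → b ≡ a - (a - b)
  back = solve-∀

-- The side of block q facing d runs counter-clockwise from vertex q d to vertex q (next d).
sideStart : Direction → Bits
sideStart south = (false , false)
sideStart east  = (true  , false)
sideStart north = (true  , true)
sideStart west  = (false , true)

sideStartingAt : Bits → Direction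
sideStartingAt (false , false) = south
sideStartingAt (true  , false) = east
sideStartingAt (true  , true)  = north
sideStartingAt (false , true)  = west

sideStartingAt-sideStart : ∀ d → sideStartingAt (sideStart d) ≡ d
sideStartingAt-sideStart south = refl
sideStartingAt-sideStart east  = refl
sideStartingAt-sideStart north = refl
sideStartingAt-sideStart west  = refl

sideStart-sideStartingAt : ∀ i → sideStart (sideStartingAt i) ≡ i
sideStart-sideStartingAt (false , false) = refl
sideStart-sideStartingAt (true  , false) = refl
sideStart-sideStartingAt (true  , true)  = refl
sideStart-sideStartingAt (false , true)  = refl

vertex : Point → Direction → Point
vertex q d = corner q (sideStart d)

vertex-injective : ∀ {q q′} d d′ → vertex q d ≡ vertex q′ d′ → q ≡ q′ × d ≡ d′
vertex-injective d d′ eq with corner-injective (sideStart d) (sideStart d′) eq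
... | q≡q′ , start≡ =
  q≡q′ , trans (sym (sideStartingAt-sideStart d))
               (trans (cong sideStartingAt start≡) (sideStartingAt-sideStart d′))

block-vertex : ∀ q d → block (vertex q d) ≡ q
block-vertex q d = block-corner q (sideStart d)

vertex-block : ∀ z → ∃ λ d → z ≡ vertex (block z) d
vertex-block z with corner-block z
... | i , z≡ = sideStartingAt i , trans z≡ (cong (corner (block z)) (sym (sideStart-sideStartingAt i)))

_-ᵇ_ : Bits → Bits → Point
(i₁ , i₂) -ᵇ (j₁ , j₂) = (bit i₁ - bit j₁ , bit i₂ - bit j₂)

_+ᵖ_ : Point → Point → Point
(a₁ , a₂) +ᵖ (b₁ , b₂) = (a₁ + b₁ , a₂ + b₂)

twice : Point → Point
twice (a₁ , a₂) = (+ 2 * a₁ , + 2 * a₂)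

corner-diff : ∀ q i j → corner q i -ᵖ corner q j ≡ i -ᵇ j
corner-diff (a , b) (i₁ , i₂) (j₁ , j₂) = cong₂ _,_ (cancel a (bit i₁) (bit j₁)) (cancel b (bit i₂) (bit j₂))
  where
  cancel : ∀ a x y → + 2 * a + x - (+ 2 * a + y) ≡ x - y
  cancel = solve-∀

corner-neighbour-diff : ∀ p d i j → corner p i -ᵖ corner (neighbour p d) j ≡ (i -ᵇ j) +ᵖ twice (edgeVector d)
corner-neighbour-diff (a , b) d (i₁ , i₂) (j₁ , j₂) =
  cong₂ _,_ (cancel a (proj₁ (edgeVector d)) (bit i₁) (bit j₁)) (cancel b (proj₂ (edgeVector d)) (bit i₂) (bit j₂))
  where
  cancel : ∀ a e x y → + 2 * a + x - (+ 2 * (a - e) + y) ≡ x - y + + 2 * e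
  cancel = solve-∀

corner-adjacent : ∀ q i j → i -ᵇ j ∈ U₂ → corner q i ∼ corner q j
corner-adjacent q i j = subst (_∈ U₂) (sym (corner-diff q i j))

corner-neighbour-adjacent : ∀ p d i j → (i -ᵇ j) +ᵖ twice (edgeVector d) ∈ U₂ → corner p i ∼ corner (neighbour p d) j
corner-neighbour-adjacent p d i j = subst (_∈ U₂) (sym (corner-neighbour-diff p d i j))

side-adjacent : ∀ q d → vertex q d ∼ vertex q (next d)
side-adjacent q d = corner-adjacent q _ _ (unit d)
  where
  unit : ∀ d → sideStart d -ᵇ sideStart (next d) ∈ U₂
  unit south = decide∈U₂
  unit east  = decide∈U₂
  unit north = decide∈U₂
  unit west  = decide∈U₂

entry-adjacent : ∀ p d → vertex p d ∼ vertex (neighbour p d) (prev d)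
entry-adjacent p d = corner-neighbour-adjacent p d _ _ (unit d)
  where
  unit : ∀ d → (sideStart d -ᵇ sideStart (prev d)) +ᵖ twice (edgeVector d) ∈ U₂
  unit south = decide∈U₂
  unit east  = decide∈U₂
  unit north = decide∈U₂
  unit west  = decide∈U₂

exit-adjacent : ∀ p d → vertex p (next d) ∼ vertex (neighbour p d) (opposite d)
exit-adjacent p d = corner-neighbour-adjacent p d _ _ (unit d)
  where
  unit : ∀ d → (sideStart (next d) -ᵇ sideStart (opposite d)) +ᵖ twice (edgeVector d) ∈ U₂
  unit south = decide∈U₂
  unit east  = decide∈U₂
  unit north = decide∈U₂
  unit west  = decide∈U₂

rotations : Direction → List Direction
rotations d = prev d ∷ d ∷ next d ∷ opposite d ∷ []

rotations-complete : ∀ d k → k ∈ rotations d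
rotations-complete south west  = here refl
rotations-complete south south = there (here refl)
rotations-complete south east  = there (there (here refl))
rotations-complete south north = there (there (there (here refl)))
rotations-complete east  south = here refl
rotations-complete east  east  = there (here refl)
rotations-complete east  north = there (there (here refl))
rotations-complete east  west  = there (there (there (here refl)))
rotations-complete north east  = here refl
rotations-complete north north = there (here refl)
rotations-complete north west  = there (there (here refl))
rotations-complete north south = there (there (there (here refl)))
rotations-complete west  north = here refl
rotations-complete west  west  = there (here refl)
rotations-complete west  south = there (there (here refl))
rotations-complete west  east  = there (there (there (here refl)))

rotations-unique : ∀ d → Unique (rotations d)
rotations-unique south = ((λ ()) ∷ (λ ()) ∷ (λ ()) ∷ []) ∷ ((λ ()) ∷ (λ ()) ∷ []) ∷ ((λ ()) ∷ []) ∷ [] ∷ []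
rotations-unique east  = ((λ ()) ∷ (λ ()) ∷ (λ ()) ∷ []) ∷ ((λ ()) ∷ (λ ()) ∷ []) ∷ ((λ ()) ∷ []) ∷ [] ∷ []
rotations-unique north = ((λ ()) ∷ (λ ()) ∷ (λ ()) ∷ []) ∷ ((λ ()) ∷ (λ ()) ∷ []) ∷ ((λ ()) ∷ []) ∷ [] ∷ []
rotations-unique west  = ((λ ()) ∷ (λ ()) ∷ (λ ()) ∷ []) ∷ ((λ ()) ∷ (λ ()) ∷ []) ∷ ((λ ()) ∷ []) ∷ [] ∷ []

-- The corners of q counter-clockwise, arranged so that consecutive corners span every side of q
-- except the one facing opposite d.
perimeter : Point → Direction → List Point
perimeter q d = map (vertex q) (rotations d)

perimeter-unique : ∀ q d → Unique (perimeter q d)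
perimeter-unique q d = Unique.map⁺ {f = vertex q} (λ {k} {k′} eq → proj₂ (vertex-injective {q} {q} k k′ eq)) (rotations-unique d)

∈-perimeter⁻ : ∀ {z q} d → z ∈ perimeter q d → block z ≡ q
∈-perimeter⁻ {z} {q} d z∈ with ∈-map⁻ (vertex q) {xs = rotations d} z∈
... | k , _ , refl = block-vertex q k

∈-perimeter⁺ : ∀ {z q} d → block z ≡ q → z ∈ perimeter q d
∈-perimeter⁺ {z} d refl with vertex-block z
... | k , z≡ = subst (_∈ perimeter (block z) d) (sym z≡) (∈-map⁺ (vertex (block z)) (rotations-complete d k))

perimeter-sides : ∀ q d k → k ≡ opposite d ⊎ Consecutive (vertex q k) (vertex q (next k)) (perimeter q d)
perimeter-sides q d k with rotations-complete d k
... | here refl = inj₂ (subst (λ k′ → Consecutive (vertex q (prev d)) (vertex q k′) (perimeter q d)) (sym (next-prev d)) here)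
... | there (here refl)                 = inj₂ (there here)
... | there (there (here refl))         = inj₂ (there (there here))
... | there (there (there (here refl))) = inj₁ refl

detour-linked : ∀ p d → Linked _∼_ (vertex p d ∷ perimeter (neighbour p d) d ++ vertex p (next d) ∷ [])
detour-linked p d =
  entry-adjacent p d ∷
  subst (vertex q (prev d) ∼_) (cong (vertex q) (next-prev d)) (side-adjacent q (prev d)) ∷
  side-adjacent q d ∷ side-adjacent q (next d) ∷ ∼-sym {vertex p (next d)} (exit-adjacent p d) ∷ [-]
  where q = neighbour p d

-- A cycle through the corners of the blocks ss, read as start ∷ tour with start = last tour,
-- which traverses every boundary side of the region counter-clockwise.
record BoundaryTour (ss : List Point) : Set where
  field
    start    : Point
    tour     : List Point
    closes   : last tour ≡ just start
    linked   : Linked _∼_ (start ∷ tour)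
    distinct : Unique tour
    long     : 3 ≤ length tour
    covers   : ∀ z → z ∈ tour ⇔ block z ∈ ss
    boundary : ∀ {p} d → p ∈ ss → neighbour p d ∉ ss →
               Consecutive (vertex p d) (vertex p (next d)) (start ∷ tour)

single-block-tour : ∀ x → BoundaryTour (x ∷ [])
single-block-tour x = record
  { start    = vertex x west
  ; tour     = perimeter x east
  ; closes   = refl
  ; linked   = side-adjacent x west ∷ side-adjacent x south ∷ side-adjacent x east ∷ side-adjacent x north ∷ [-]
  ; distinct = perimeter-unique x east
  ; long     = ℕ.n≤1+n 3
  ; covers   = λ z → mk⇔ (λ z∈ → here (∈-perimeter⁻ east z∈)) (λ { (here eq) → ∈-perimeter⁺ east eq ; (there ()) })
  ; boundary = sides
  }
  where
  sides : ∀ {p} d → p ∈ x ∷ [] → neighbour p d ∉ x ∷ [] →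
          Consecutive (vertex p d) (vertex p (next d)) (vertex x west ∷ perimeter x east)
  sides d (here refl) _ with perimeter-sides x east d
  ... | inj₁ refl = here
  ... | inj₂ side = there side

extend : ∀ {ss p} d → BoundaryTour ss → p ∈ ss → neighbour p d ∉ ss → BoundaryTour (neighbour p d ∷ ss)
extend {ss} {p} d T p∈ q∉ with splice-closed (perimeter (neighbour p d) d) (BoundaryTour.boundary T d p∈ q∉)
... | tour′ , splice≡ , tour′↭ , last≡ = record
  { start    = start
  ; tour     = tour′
  ; closes   = trans last≡ closes
  ; linked   = subst (Linked _∼_) splice≡ (splice-linked N side linked (detour-linked p d))
  ; distinct = Unique-resp-↭ (↭-sym tour′↭) (Unique.++⁺ (perimeter-unique q d) distinct disjoint)
  ; long     = subst (3 ≤_) (sym (↭-length tour′↭)) (ℕ.≤-trans long (ℕ.m≤n+m _ 4))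
  ; covers   = λ z → mk⇔ (covers⁺ z) (covers⁻ z)
  ; boundary = boundary′
  }
  where
  open BoundaryTour T
  q = neighbour p d
  N = perimeter q d
  side = boundary d p∈ q∉

  disjoint : Disjoint N tour
  disjoint (z∈N , z∈tour) = q∉ (subst (_∈ ss) (∈-perimeter⁻ d z∈N) (Equivalence.to (covers _) z∈tour))

  covers⁺ : ∀ z → z ∈ tour′ → block z ∈ q ∷ ss
  covers⁺ z z∈ with ∈-++⁻ N (∈-resp-↭ tour′↭ z∈)
  ... | inj₁ z∈N    = here (∈-perimeter⁻ d z∈N)
  ... | inj₂ z∈tour = there (Equivalence.to (covers z) z∈tour)

  covers⁻ : ∀ z → block z ∈ q ∷ ss → z ∈ tour′
  covers⁻ z (here eq) = ∈-resp-↭ (↭-sym tour′↭) (∈-++⁺ˡ (∈-perimeter⁺ d eq))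
  covers⁻ z (there b∈) = ∈-resp-↭ (↭-sym tour′↭) (∈-++⁺ʳ N (Equivalence.from (covers z) b∈))

  boundary′ : ∀ {p′} k → p′ ∈ q ∷ ss → neighbour p′ k ∉ q ∷ ss →
              Consecutive (vertex p′ k) (vertex p′ (next k)) (start ∷ tour′)
  boundary′ k (here refl) nb∉ with perimeter-sides q d k
  ... | inj₁ refl = ⊥-elim (nb∉ (there (subst (_∈ ss) (sym (neighbour-opposite p d)) p∈)))
  ... | inj₂ q-side = subst (Consecutive _ _) splice≡ (splice-inner N side q-side)
  boundary′ {p′} k (there p′∈) nb∉ =
    subst (Consecutive _ _) splice≡ (splice-outer N side (boundary k p′∈ (nb∉ ∘ there)) not-removed)
    where
    not-removed : ¬ (vertex p′ k ≡ vertex p d × vertex p′ (next k) ≡ vertex p (next d))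
    not-removed (same-start , _) with vertex-injective {p′} {p} k d same-start
    ... | refl , refl = nb∉ (here refl)

module Saturation (xs : List Point) where

  Closed : List Point → Set
  Closed ss = ∀ {p} d → p ∈ ss → neighbour p d ∈ xs → neighbour p d ∈ ss

  frontier? : ∀ ss p d → Dec (neighbour p d ∈ xs × neighbour p d ∉ ss)
  frontier? ss p d = (neighbour p d ∈? xs) ×-dec ¬? (neighbour p d ∈? ss)

  frontier-or-closed : ∀ ss → (∃₂ λ p d → p ∈ ss × neighbour p d ∈ xs × neighbour p d ∉ ss) ⊎ Closed ss
  frontier-or-closed ss with any? (λ p → any? (frontier? ss p) (rotations east)) ss
  ... | yes found with find found
  ...   | p , p∈ , found-d with find found-d
  ...     | d , _ , q∈ , q∉ = inj₁ (p , d , p∈ , q∈ , q∉)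
  frontier-or-closed ss | no none = inj₂ closed
    where
    closed : Closed ss
    closed {p} d p∈ q∈ with neighbour p d ∈? ss
    ... | yes q∈ss = q∈ss
    ... | no  q∉ss = ⊥-elim (none (lose p∈ (lose (rotations-complete east d) (q∈ , q∉ss))))

  -- rest contains the blocks of xs still missing from ss and shrinks at every extension.
  grow : ∀ n rest {ss} → length rest < n → (∀ {z} → z ∈ xs → z ∉ ss → z ∈ rest) →
         ss ⊆ xs → BoundaryTour ss → ∃ λ ss′ → BoundaryTour ss′ × ss′ ⊆ xs × ss ⊆ ss′ × Closed ss′
  grow (suc n) rest {ss} (s≤s |rest|≤n) pending ss⊆xs T with frontier-or-closed ss
  ... | inj₂ closed = ss , T , ss⊆xs , id , closed
  ... | inj₁ (p , d , p∈ , q∈ , q∉)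
    with grow n rest′ shrinks pending′ q∷ss⊆xs (extend d T p∈ q∉)
    where
    q = neighbour p d
    ≢q? : ∀ z → Dec (z ≢ q)
    ≢q? z = ¬? (≡-dec _≟_ _≟_ z q)
    rest′ = filter ≢q? rest
    shrinks : length rest′ < n
    shrinks = ℕ.<-≤-trans (filter-notAll ≢q? rest (lose (pending q∈ q∉) (λ q≢q → q≢q refl))) |rest|≤n
    pending′ : ∀ {z} → z ∈ xs → z ∉ q ∷ ss → z ∈ rest′
    pending′ z∈ z∉ = ∈-filter⁺ ≢q? (pending z∈ (z∉ ∘ there)) (z∉ ∘ here)
    q∷ss⊆xs : q ∷ ss ⊆ xs
    q∷ss⊆xs (here refl) = q∈
    q∷ss⊆xs (there z∈)  = ss⊆xs z∈
  ... | ss′ , T′ , ss′⊆xs , q∷ss⊆ss′ , closed = ss′ , T′ , ss′⊆xs , q∷ss⊆ss′ ∘ there , closed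

  saturate : ∀ {x} → x ∈ xs → ∃ λ ss → BoundaryTour ss × ss ⊆ xs × x ∈ ss × Closed ss
  saturate {x} x∈
    with grow (suc (length xs)) xs ℕ.≤-refl (λ z∈ _ → z∈) single⊆xs (single-block-tour x)
    where
    single⊆xs : x ∷ [] ⊆ xs
    single⊆xs (here refl) = x∈
  ... | ss , T , ss⊆xs , x∷[]⊆ss , closed = ss , T , ss⊆xs , x∷[]⊆ss (here refl) , closed

  walk-stays-in-closed : ∀ {V ss a b} → (∀ {z} → V z → z ∈ xs) → Closed ss → a ∈ ss → Walk V a b → b ∈ ss
  walk-stays-in-closed {V} {ss} V⊆xs closed a∈ record { verts = _ ∷ _ ; start = refl ; end = end ; steps = steps } =
    All-last (propagate a∈ steps) end
    where
    propagate : ∀ {v vs} → v ∈ ss → Linked (Adj V) (v ∷ vs) → All (_∈ ss) (v ∷ vs)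
    propagate v∈ [-] = v∈ ∷ []
    propagate {v} {w ∷ _} v∈ ((_ , Vw , v∼w) ∷ l) with ∼⇒neighbour {v} {w} v∼w
    ... | d , refl = v∈ ∷ propagate (closed d v∈ (V⊆xs Vw)) l

  connected-tour : ∀ {X} → (∀ q → X q ⇔ q ∈ xs) → Connected X →
                   ∃ λ ss → BoundaryTour ss × (∀ q → X q ⇔ q ∈ ss)
  connected-tour X⇔xs ((x , Xx) , walk) with saturate (Equivalence.to (X⇔xs x) Xx)
  ... | ss , T , ss⊆xs , x∈ss , closed = ss , T , λ q → mk⇔
    (λ Xq → walk-stays-in-closed (Equivalence.to (X⇔xs _)) closed x∈ss (walk x q Xx Xq))
    (λ q∈ → Equivalence.from (X⇔xs q) (ss⊆xs q∈))

linked-Adj : ∀ {V : Point → Set} {zs} → Linked _∼_ zs → All V zs → Linked (Adj V) zs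
linked-Adj []      _                    = []
linked-Adj [-]     _                    = [-]
linked-Adj (r ∷ l) (Va ∷ Vzs@(Vb ∷ _)) = (Va , Vb , r) ∷ linked-Adj l Vzs

closing-Adj : ∀ {V : Point → Set} {s zs} → All V zs → last zs ≡ just s → Linked _∼_ (s ∷ zs) →
              ∀ a b → last zs ≡ just a → head zs ≡ just b → Adj V a b
closing-Adj Vzs closes (s∼h ∷ _) a b last≡a refl with just-injective (trans (sym last≡a) closes)
... | refl = All-last Vzs last≡a , All.head Vzs , s∼h

boundaryTour⇒hamiltonianCycle : ∀ {V ss} → BoundaryTour ss → (∀ z → V z ⇔ block z ∈ ss) → HamiltonianCycle V
boundaryTour⇒hamiltonianCycle {V} T V⇔ss = record
  { cycle    = tour
  ; long     = long
  ; distinct = distinct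
  ; spanning = λ z → mk⇔ (to-tour z) (from-tour z)
  ; path     = linked-Adj (Linked.tail linked) (All.tabulate (from-tour _))
  ; closing  = closing-Adj (All.tabulate (from-tour _)) closes linked
  }
  where
  open BoundaryTour T
  to-tour : ∀ z → V z → z ∈ tour
  to-tour z Vz = Equivalence.from (covers z) (Equivalence.to (V⇔ss z) Vz)
  from-tour : ∀ z → z ∈ tour → V z
  from-tour z z∈ = Equivalence.from (V⇔ss z) (Equivalence.to (covers z) z∈)

lemma3p3 : (X : Point → Set) → Finite X → Shape X → HamiltonianCycle (Blowup X)
lemma3p3 X (xs , X⇔xs) shape with Saturation.connected-tour xs X⇔xs shape
... | ss , T , X⇔ss = boundaryTour⇒hamiltonianCycle T (X⇔ss ∘ block)
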